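{- (Probability regeneration for perfect matchings of $K_n^{(s)}$.) Let $s\ge2$, $n$ a multiple of $s$, and $e=\{x_1<x_2<\dots<x_s\}\subseteq[n]$. Let $M$ be drawn uniformly from the set of perfect matchings of $K_n^{(s)}$ containing the edge $e$, and independently let $z_2,\dots,z_s$ be independent with $z_i$ uniform on $[n]\setminus\{x_1,\dots,x_{i-1}\}$. Let $\sigma=(x_2\ z_2)(x_3\ z_3)\cdots(x_s\ z_s)$. Then $\sigma M$ is uniformly distributed on the set of all perfect matchings of $K_n^{(s)}$.
   Context: $K_n^{(s)}$ is the complete $s$-uniform hypergraph on $[n]$; a perfect matching is a partition of $[n]$ into $n/s$ sets of size $s$. Permutations multiply as functional composition, $(a\ b)$ denotes the transposition swapping $a,b$ (identity if $a=b$), and a permutation $\sigma$ acts on a matching $M$ by $\sigma M=\{\{\sigma y_1,\dots,\sigma y_s\}:\{y_1,\dots,y_s\}\in M\}$. -}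

module Defs where

open import Data.Nat using (ℕ; suc; _≡ᵇ_; _≤ᵇ_)
open import Data.Bool using (Bool; true; false; _∧_; _∨_; not; if_then_else_; T)
open import Data.Fin using (Fin; zero; suc; toℕ; _<_)
open import Data.Fin.Properties using () renaming (_≟_ to _≟F_)
open import Data.Fin.Subset using (Subset; ∣_∣)
open import Data.Vec using (Vec; lookup; tabulate; toList)
open import Data.Vec.Properties using (≡-dec)
open import Data.Bool.Properties using () renaming (_≟_ to _≟B_)
open import Data.List using (List; []; _∷_; allFin)
open import Data.Bool.ListAction using () renaming (all to allL; any to anyL)
open import Data.Product using (Σ; _×_; _,_; proj₁)
open import Relation.Nullary.Decidable using (⌊_⌋)
open import Relation.Binary.PropositionalEquality using (_≡_)

_==F_ : ∀ {n} → Fin n → Fin n → Bool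
a ==F b = ⌊ a ≟F b ⌋

_==S_ : ∀ {n} → Subset n → Subset n → Bool
S ==S T′ = ⌊ ≡-dec _≟B_ S T′ ⌋

allF : ∀ {n} → (Fin n → Bool) → Bool
allF {n} p = allL p (allFin n)

anyF : ∀ {n} → (Fin n → Bool) → Bool
anyF {n} p = anyL p (allFin n)

-- A candidate matching on [n] is encoded canonically by assigning to every
-- vertex w the block (an s-subset of [n]) containing w.
isPerfectMatching : ∀ {n} → ℕ → Vec (Subset n) n → Bool
isPerfectMatching {n} s v =
  allF λ w → lookup (lookup v w) w
           ∧ (∣ lookup v w ∣ ≡ᵇ s)
           ∧ allF (λ y → not (lookup (lookup v w) y) ∨ (lookup v y ==S lookup v w))

PM : ℕ → ℕ → Set
PM n s = Σ (Vec (Subset n) n) (λ v → T (isPerfectMatching s v))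

swap : ∀ {n} → Fin n → Fin n → Fin n → Fin n
swap a b y = if y ==F a then b else (if y ==F b then a else y)

prodSwaps : ∀ {n} → List (Fin n × Fin n) → Fin n → Fin n
prodSwaps []             y = y
prodSwaps ((a , b) ∷ ps) y = swap a b (prodSwaps ps y)

image : ∀ {n} → (Fin n → Fin n) → Subset n → Subset n
image σ S = tabulate λ w → anyF λ y → lookup S y ∧ (σ y ==F w)

-- Action σM = {σB : B ∈ M}: the block of w in σM is the union of σ(block of y)
-- over all y with σ y = w.
act : ∀ {n} → (Fin n → Fin n) → Vec (Subset n) n → Vec (Subset n) n
act σ v = tabulate λ w → tabulate λ u →
  anyF λ y → (σ y ==F w) ∧ lookup (image σ (lookup v y)) u

-- The edge e = {x_1 < ... < x_s} as a subset (x indexed 0-based by Fin s)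
edgeSet : ∀ {n s} → (Fin s → Fin n) → Subset n
edgeSet x = tabulate λ w → anyF λ k → w ==F x k

StrictlyIncreasing : ∀ {n s} → (Fin s → Fin n) → Set
StrictlyIncreasing x = ∀ i j → i < j → x i < x j

-- Perfect matchings containing the edge e (the block of x_1 equals e)
PMe : ∀ n t → (Fin (suc t) → Fin n) → Set
PMe n t x = Σ (PM n (suc t)) λ M → T (lookup (proj₁ M) (x zero) ==S edgeSet x)

-- Choices (z_2,...,z_s): entry j (0-based, j < t = s-1) is z_{j+2}, which must lie
-- in [n] \ {x_1,...,x_{j+1}}, i.e. avoid x k for 0-based k ≤ j.
validZ : ∀ {n t} → (Fin (suc t) → Fin n) → Vec (Fin n) t → Bool
validZ {n} {t} x z = allF λ (j : Fin t) → allF λ (k : Fin (suc t)) →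
  not (toℕ k ≤ᵇ toℕ j) ∨ not (lookup z j ==F x k)

Zs : ∀ n t → (Fin (suc t) → Fin n) → Set
Zs n t x = Σ (Vec (Fin n) t) λ z → T (validZ x z)

sigma : ∀ {n t} → (Fin (suc t) → Fin n) → Vec (Fin n) t → Fin n → Fin n
sigma {n} {t} x z = prodSwaps (toList (tabulate λ (j : Fin t) → (x (suc j) , lookup z j)))

Fiber : ∀ n t → (Fin (suc t) → Fin n) → PM n (suc t) → Set
Fiber n t x N = Σ (PMe n t x) λ M → Σ (Zs n t x) λ z →
  act (sigma x (proj₁ z)) (proj₁ (proj₁ M)) ≡ proj₁ N

module Submission where

-- Uniformity of σM is stated as: all fibres of (M, z) ↦ σ_z M are in bijection.
-- Let x₁ be the least vertex of e and B_N the block of x₁ in N.  Every σ_z fixes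
-- x₁, so σ_z M = N with e ∈ M forces M = σ_z⁻¹ N, and this M contains e exactly
-- when σ_z carries e onto B_N.  Thus the fibre over N corresponds to the
-- admissible z with σ_z e = B_N (fibre↔carriers), and these correspond to the
-- enumerations (y₂, …, y_s) of B_N ∖ {x₁} via z ↦ (σ_z x₂, …, σ_z x_s)
-- (carriers↔enumerations).  The latter bijection is proved for any product of
-- transpositions along a fresh vector, with an explicit recursive inverse
-- (images, recover).  Finally two blocks of size s containing x₁ are carried
-- onto each other by a permutation fixing x₁ (carried-fixing), and relabelling
-- by it matches up their enumerations (enumerations↔).

open import Defs
open import Data.Nat using (ℕ; suc; _≤_)
open import Data.Nat.Divisibility using (_∣_)
open import Data.Fin using (Fin)
open import Function.Bundles using (_↔_)

open import Data.Nat using (zero; _≡ᵇ_; _≤ᵇ_; s≤s; z≤n)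
open import Data.Nat.Properties using (+-0-commutativeMonoid; ≡ᵇ⇒≡; ≡⇒≡ᵇ; ≤ᵇ⇒≤; ≤⇒≤ᵇ; suc-injective)
open import Data.Bool using (Bool; true; false; _∧_; _∨_; not; T)
open import Data.Bool.Properties using (T-∧; T-∨; T-not-≡; T-≡; T-irrelevant) renaming (_≟_ to _≟B_)
open import Data.Fin using (zero; suc; toℕ)
open import Data.Fin.Properties using (<-cmp; <⇒≢) renaming (_≟_ to _≟F_; suc-injective to Fin-suc-injective)
open import Data.Fin.Subset using (Subset; ∣_∣)
open import Data.Fin.Permutation
  using (Permutation′; permutation; _⟨$⟩ʳ_; _⟨$⟩ˡ_; inverseˡ; inverseʳ; _∘ₚ_; flip; lift₀)
  renaming (id to idₚ)
open import Data.Vec using (Vec; []; _∷_; lookup; tabulate; map)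
open import Data.Vec.Properties using (lookup∘tabulate; lookup-map; map-∘; map-cong; map-id; ≡-dec)
open import Data.Vec.Relation.Binary.Pointwise.Extensional using (ext; Pointwise-≡⇒≡)
open import Data.List using (allFin)
open import Data.List.Relation.Unary.Any using (satisfied)
open import Data.List.Relation.Unary.Any.Properties using (any⁺; any⁻)
import Data.List.Relation.Unary.All as All
open import Data.List.Relation.Unary.All.Properties using (all⁺; all⁻)
open import Data.List.Membership.Propositional using (lose)
open import Data.List.Membership.Propositional.Properties using (∈-allFin)
open import Data.Product using (Σ; ∃; _×_; _,_; proj₁; proj₂)
open import Data.Sum using (_⊎_; inj₁; inj₂; [_,_]′)
open import Data.Empty using (⊥; ⊥-elim)
open import Data.Unit using (⊤; tt)
open import Relation.Nullary using (¬_)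
open import Relation.Nullary.Decidable using (toWitness; fromWitness; recompute; T?)
open import Relation.Binary using (tri<; tri≈; tri>)
open import Relation.Binary.PropositionalEquality
open import Function.Bundles using (Equivalence; Injection; mk↔ₛ′)
open import Function.Properties.Inverse using (↔-trans; ↔-sym; ↔⇒↣)
open import Axiom.UniquenessOfIdentityProofs using (module Decidable⇒UIP)
open import Algebra.Properties.CommutativeMonoid.Sum +-0-commutativeMonoid
  using (sum; sum-permute; sum-cong-≗)

==F⇒≡ : ∀ {n} {a b : Fin n} → T (a ==F b) → a ≡ b
==F⇒≡ = toWitness

≡⇒==F : ∀ {n} {a b : Fin n} → a ≡ b → T (a ==F b)
≡⇒==F = fromWitness

==S⇒≡ : ∀ {n} {S S′ : Subset n} → T (S ==S S′) → S ≡ S′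
==S⇒≡ = toWitness

≡⇒==S : ∀ {n} {S S′ : Subset n} → S ≡ S′ → T (S ==S S′)
≡⇒==S = fromWitness

anyF⇒∃ : ∀ {n} (p : Fin n → Bool) → T (anyF p) → ∃ λ k → T (p k)
anyF⇒∃ {n} p h = satisfied (any⁻ p (allFin n) h)

∃⇒anyF : ∀ {n} (p : Fin n → Bool) k → T (p k) → T (anyF p)
∃⇒anyF p k pk = any⁺ p (lose (∈-allFin k) pk)

allF⇒∀ : ∀ {n} (p : Fin n → Bool) → T (allF p) → ∀ k → T (p k)
allF⇒∀ {n} p h k = All.lookup (all⁺ p (allFin n) h) (∈-allFin k)

∀⇒allF : ∀ {n} (p : Fin n → Bool) → (∀ k → T (p k)) → T (allF p)
∀⇒allF {n} p h = all⁻ p {allFin n} (All.tabulate λ {k} _ → h k)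

true⇒≡ : ∀ {n} {a b : Fin n} → (a ==F b) ≡ true → a ≡ b
true⇒≡ p = ==F⇒≡ (subst T (sym p) tt)

false⇒≢ : ∀ {n} {a b : Fin n} → (a ==F b) ≡ false → a ≢ b
false⇒≢ p a≡b = subst T p (≡⇒==F a≡b)

T-ext : ∀ {a b : Bool} → (T a → T b) → (T b → T a) → a ≡ b
T-ext {false} {false} _ _ = refl
T-ext {false} {true}  _ g = ⊥-elim (g tt)
T-ext {true}  {false} f _ = ⊥-elim (f tt)
T-ext {true}  {true}  _ _ = refl

vec-ext : ∀ {A : Set} {m} {u v : Vec A m} → (∀ i → lookup u i ≡ lookup v i) → u ≡ v
vec-ext h = Pointwise-≡⇒≡ (ext h)

data SwapView {n} (a b y : Fin n) : Set where
  at-a      : y ≡ a → swap a b y ≡ b → SwapView a b y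
  at-b      : y ≢ a → y ≡ b → swap a b y ≡ a → SwapView a b y
  elsewhere : y ≢ a → y ≢ b → swap a b y ≡ y → SwapView a b y

swapView : ∀ {n} (a b y : Fin n) → SwapView a b y
swapView a b y with y ==F a in ya | y ==F b in yb
... | true  | _     = at-a (true⇒≡ ya) eval
  where
  eval : swap a b y ≡ b
  eval rewrite ya = refl
... | false | true  = at-b (false⇒≢ ya) (true⇒≡ yb) eval
  where
  eval : swap a b y ≡ a
  eval rewrite ya | yb = refl
... | false | false = elsewhere (false⇒≢ ya) (false⇒≢ yb) eval
  where
  eval : swap a b y ≡ y
  eval rewrite ya | yb = refl

swap-a : ∀ {n} (a b : Fin n) → swap a b a ≡ b
swap-a a b with swapView a b a
... | at-a _ e          = e
... | at-b a≢a _ _      = ⊥-elim (a≢a refl)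
... | elsewhere a≢a _ _ = ⊥-elim (a≢a refl)

swap-b : ∀ {n} (a b : Fin n) → swap a b b ≡ a
swap-b a b with swapView a b b
... | at-a b≡a e        = trans e b≡a
... | at-b _ _ e        = e
... | elsewhere _ b≢b _ = ⊥-elim (b≢b refl)

swap-involutive : ∀ {n} (a b y : Fin n) → swap a b (swap a b y) ≡ y
swap-involutive a b y with swapView a b y
... | at-a refl e      = trans (cong (swap y b) e) (swap-b y b)
... | at-b _ refl e    = trans (cong (swap a y) e) (swap-a a y)
... | elsewhere _ _ e  = trans (cong (swap a b) e) e

swap-comm : ∀ {n} (a b y : Fin n) → swap a b y ≡ swap b a y
swap-comm a b y with swapView a b y | swapView b a y
... | at-a y≡a e       | at-a y≡b e′       = trans e (trans (sym y≡b) (trans y≡a (sym e′)))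
... | at-a _ e         | at-b _ _ e′       = trans e (sym e′)
... | at-a y≡a _       | elsewhere _ y≢a _ = ⊥-elim (y≢a y≡a)
... | at-b _ _ e       | at-a _ e′         = trans e (sym e′)
... | at-b y≢a _ _     | at-b _ y≡a _     = ⊥-elim (y≢a y≡a)
... | at-b _ y≡b _     | elsewhere y≢b _ _ = ⊥-elim (y≢b y≡b)
... | elsewhere _ y≢b _ | at-a y≡b _       = ⊥-elim (y≢b y≡b)
... | elsewhere y≢a _ _ | at-b _ y≡a _     = ⊥-elim (y≢a y≡a)
... | elsewhere _ _ e  | elsewhere _ _ e′  = trans e (sym e′)

transposition : ∀ {n} → Fin n → Fin n → Permutation′ n
transposition a b = permutation (swap a b) (swap a b) (swap-involutive a b) (swap-involutive a b)

permutation-injective : ∀ {n} (π : Permutation′ n) {u v} → π ⟨$⟩ʳ u ≡ π ⟨$⟩ʳ v → u ≡ v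
permutation-injective π = Injection.injective (↔⇒↣ π)

-- swaps as zs = (a₁ z₁)(a₂ z₂)⋯(a_m z_m); the rightmost factor acts first.
swaps : ∀ {n m} → Vec (Fin n) m → Vec (Fin n) m → Permutation′ n
swaps []       []       = idₚ
swaps (a ∷ as) (z ∷ zs) = swaps as zs ∘ₚ transposition a z

VSet : ℕ → Set₁
VSet n = Fin n → Set

_∪｛_｝ : ∀ {n} → VSet n → Fin n → VSet n
(F ∪｛ a ｝) u = F u ⊎ u ≡ a

Fresh : ∀ {n m} → VSet n → Vec (Fin n) m → Set
Fresh F []       = ⊤
Fresh F (y ∷ ys) = ¬ F y × Fresh (F ∪｛ y ｝) ys

-- zs is admissible for as over F: z_j avoids F and a₁, …, a_{j-1}.
-- For F = {x₁} and as = (x₂, …, x_s) these are the choices (z₂, …, z_s).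
Admissible : ∀ {n m} → VSet n → Vec (Fin n) m → Vec (Fin n) m → Set
Admissible F []       []       = ⊤
Admissible F (a ∷ as) (z ∷ zs) = ¬ F z × Admissible (F ∪｛ a ｝) as zs

swaps-fixes : ∀ {n m} (F : VSet n) (as zs : Vec (Fin n) m) → Fresh F as → Admissible F as zs →
  ∀ w → F w → swaps as zs ⟨$⟩ʳ w ≡ w
swaps-fixes F []       []       _          _          w _  = refl
swaps-fixes F (a ∷ as) (z ∷ zs) (a∉F , as-fresh) (z∉F , zs-adm) w w∈F =
  begin
    swap a z (swaps as zs ⟨$⟩ʳ w) ≡⟨ cong (swap a z) (swaps-fixes (F ∪｛ a ｝) as zs as-fresh zs-adm w (inj₁ w∈F)) ⟩
    swap a z w                    ≡⟨ elsewhere-fixed (swapView a z w) ⟩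
    w                             ∎
  where
  open ≡-Reasoning
  elsewhere-fixed : SwapView a z w → swap a z w ≡ w
  elsewhere-fixed (at-a w≡a _)        = ⊥-elim (a∉F (subst F w≡a w∈F))
  elsewhere-fixed (at-b _ w≡z _)      = ⊥-elim (z∉F (subst F w≡z w∈F))
  elsewhere-fixed (elsewhere _ _ e)   = e

Fresh-map : ∀ {n m} (G G′ : VSet n) (π : Permutation′ n) → (∀ w → G′ (π ⟨$⟩ʳ w) → G w) →
  (ys : Vec (Fin n) m) → Fresh G ys → Fresh G′ (map (π ⟨$⟩ʳ_) ys)
Fresh-map G G′ π back []       _               = tt
Fresh-map G G′ π back (y ∷ ys) (y∉G , ys-fresh) =
  (λ πy∈G′ → y∉G (back y πy∈G′)) ,
  Fresh-map (G ∪｛ y ｝) (G′ ∪｛ π ⟨$⟩ʳ y ｝) π back′ ys ys-fresh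
  where
  back′ : ∀ w → (G′ ∪｛ π ⟨$⟩ʳ y ｝) (π ⟨$⟩ʳ w) → (G ∪｛ y ｝) w
  back′ w (inj₁ πw∈G′) = inj₁ (back w πw∈G′)
  back′ w (inj₂ πw≡πy) = inj₂ (permutation-injective π πw≡πy)

∪-swap : ∀ {n} (F : VSet n) a b → ¬ F a → ∀ w → (F ∪｛ b ｝) (swap a b w) → (F ∪｛ a ｝) w
∪-swap F a b a∉F w h with swapView a b w
... | at-a w≡a _ = inj₂ w≡a
... | at-b _ w≡b e with subst (F ∪｛ b ｝) e h
...   | inj₁ a∈F = ⊥-elim (a∉F a∈F)
...   | inj₂ a≡b = inj₂ (trans w≡b (sym a≡b))
∪-swap F a b a∉F w h | elsewhere _ w≢b e with subst (F ∪｛ b ｝) e h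
...   | inj₁ w∈F = inj₁ w∈F
...   | inj₂ w≡b = ⊥-elim (w≢b w≡b)

∪-swap′ : ∀ {n} (F : VSet n) a b → ¬ F b → ∀ w → (F ∪｛ a ｝) (swap a b w) → (F ∪｛ b ｝) w
∪-swap′ F a b b∉F w h = ∪-swap F b a b∉F w (subst (F ∪｛ a ｝) (swap-comm a b w) h)

images : ∀ {n m} → Vec (Fin n) m → Vec (Fin n) m → Vec (Fin n) m
images as zs = map (swaps as zs ⟨$⟩ʳ_) as

-- The tail product fixes a, so the first image is z and the others are
-- the images for the tail, moved by (a z).
images-cons : ∀ {n m} (F : VSet n) a z (as zs : Vec (Fin n) m) →
  Fresh F (a ∷ as) → Admissible F (a ∷ as) (z ∷ zs) →
  images (a ∷ as) (z ∷ zs) ≡ z ∷ map (swap a z) (images as zs)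
images-cons F a z as zs (_ , as-fresh) (_ , zs-adm) = cong₂ _∷_ first rest
  where
  first : swap a z (swaps as zs ⟨$⟩ʳ a) ≡ z
  first = trans (cong (swap a z) (swaps-fixes (F ∪｛ a ｝) as zs as-fresh zs-adm a (inj₂ refl)))
                (swap-a a z)
  rest : map (λ y → swap a z (swaps as zs ⟨$⟩ʳ y)) as ≡ map (swap a z) (images as zs)
  rest = map-∘ (swap a z) (swaps as zs ⟨$⟩ʳ_) as

-- The inverse of images: the first image is z₁ itself, and undoing (a₁ z₁)
-- on the remaining images gives the images for the tail.
recover : ∀ {n m} → Vec (Fin n) m → Vec (Fin n) m → Vec (Fin n) m
recover []       []       = []
recover (a ∷ as) (y ∷ ys) = y ∷ recover as (map (swap a y) ys)

map-inverse : ∀ {A : Set} {f g : A → A} → (∀ y → f (g y) ≡ y) → ∀ {m} (ys : Vec A m) → map f (map g ys) ≡ ys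
map-inverse {f = f} {g} fg ys = trans (sym (map-∘ f g ys)) (trans (map-cong fg ys) (map-id ys))

images-fresh : ∀ {n m} (F : VSet n) (as zs : Vec (Fin n) m) →
  Fresh F as → Admissible F as zs → Fresh F (images as zs)
images-fresh F []       []       _ _ = tt
images-fresh F (a ∷ as) (z ∷ zs) as-fresh@(a∉F , as′-fresh) zs-adm@(z∉F , zs′-adm) =
  subst (Fresh F) (sym (images-cons F a z as zs as-fresh zs-adm))
    (z∉F , Fresh-map (F ∪｛ a ｝) (F ∪｛ z ｝) (transposition a z) (∪-swap F a z a∉F) (images as zs)
             (images-fresh (F ∪｛ a ｝) as zs as′-fresh zs′-adm))

shifted-fresh : ∀ {n m} (F : VSet n) a y (ys : Vec (Fin n) m) → Fresh F (y ∷ ys) →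
  Fresh (F ∪｛ a ｝) (map (swap a y) ys)
shifted-fresh F a y ys (y∉F , ys-fresh) =
  Fresh-map (F ∪｛ y ｝) (F ∪｛ a ｝) (transposition a y) (∪-swap′ F a y y∉F) ys ys-fresh

recover-admissible : ∀ {n m} (F : VSet n) (as ys : Vec (Fin n) m) →
  Fresh F as → Fresh F ys → Admissible F as (recover as ys)
recover-admissible F []       []       _ _ = tt
recover-admissible F (a ∷ as) (y ∷ ys) (_ , as-fresh) ys-fresh@(y∉F , _) =
  y∉F , recover-admissible (F ∪｛ a ｝) as (map (swap a y) ys) as-fresh (shifted-fresh F a y ys ys-fresh)

recover-images : ∀ {n m} (F : VSet n) (as zs : Vec (Fin n) m) →
  Fresh F as → Admissible F as zs → recover as (images as zs) ≡ zs
recover-images F []       []       _ _ = refl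
recover-images F (a ∷ as) (z ∷ zs) as-fresh@(_ , as′-fresh) zs-adm@(_ , zs′-adm) =
  begin
    recover (a ∷ as) (images (a ∷ as) (z ∷ zs))
      ≡⟨ cong (recover (a ∷ as)) (images-cons F a z as zs as-fresh zs-adm) ⟩
    z ∷ recover as (map (swap a z) (map (swap a z) (images as zs)))
      ≡⟨ cong (λ ys → z ∷ recover as ys) (map-inverse (swap-involutive a z) (images as zs)) ⟩
    z ∷ recover as (images as zs)
      ≡⟨ cong (z ∷_) (recover-images (F ∪｛ a ｝) as zs as′-fresh zs′-adm) ⟩
    z ∷ zs
  ∎
  where open ≡-Reasoning

images-recover : ∀ {n m} (F : VSet n) (as ys : Vec (Fin n) m) →
  Fresh F as → Fresh F ys → images as (recover as ys) ≡ ys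
images-recover F []       []       _ _ = refl
images-recover {n} {suc m} F (a ∷ as) (y ∷ ys) as-fresh@(_ , as′-fresh) ys-fresh =
  begin
    images (a ∷ as) (y ∷ recover as ys′)
      ≡⟨ images-cons F a y as (recover as ys′) as-fresh
           (recover-admissible F (a ∷ as) (y ∷ ys) as-fresh ys-fresh) ⟩
    y ∷ map (swap a y) (images as (recover as ys′))
      ≡⟨ cong (λ us → y ∷ map (swap a y) us)
           (images-recover (F ∪｛ a ｝) as ys′ as′-fresh (shifted-fresh F a y ys ys-fresh)) ⟩
    y ∷ map (swap a y) ys′
      ≡⟨ cong (y ∷_) (map-inverse (swap-involutive a y) ys) ⟩
    y ∷ ys
  ∎
  where
  open ≡-Reasoning
  ys′ : Vec (Fin n) m
  ys′ = map (swap a y) ys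

Carries : ∀ {n} → Permutation′ n → Subset n → Subset n → Set
Carries π B B′ = ∀ u → lookup B′ (π ⟨$⟩ʳ u) ≡ lookup B u

carries-inverse : ∀ {n} (π : Permutation′ n) (B B′ : Subset n) → Carries π B B′ → Carries (flip π) B′ B
carries-inverse π B B′ carries u = trans (sym (carries (π ⟨$⟩ˡ u))) (cong (lookup B′) (inverseʳ π))

remove-element : ∀ {n} (B : Subset n) k → ∣ B ∣ ≡ suc k →
  Σ (Fin n) λ j → lookup B j ≡ true ×
  Σ (Subset n) λ B′ → ∣ B′ ∣ ≡ k × lookup B′ j ≡ false × (∀ i → i ≢ j → lookup B′ i ≡ lookup B i)
remove-element (true ∷ B) k size = zero , refl , false ∷ B , suc-injective size , refl , agree
  where
  agree : ∀ i → i ≢ zero → lookup (false ∷ B) i ≡ lookup (true ∷ B) i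
  agree zero    i≢0 = ⊥-elim (i≢0 refl)
  agree (suc i) _   = refl
remove-element (false ∷ B) k size with remove-element B k size
... | j , j∈B , B′ , size′ , j∉B′ , agree = suc j , j∈B , false ∷ B′ , size′ , j∉B′ , agree′
  where
  agree′ : ∀ i → i ≢ suc j → lookup (false ∷ B′) i ≡ lookup (false ∷ B) i
  agree′ zero    _   = refl
  agree′ (suc i) i≢j = agree i (λ i≡j → i≢j (cong suc i≡j))

equal-size⇒carried : ∀ {n} (B B′ : Subset n) → ∣ B ∣ ≡ ∣ B′ ∣ →
  Σ (Permutation′ n) λ π → Carries π B B′
equal-size⇒carried []      []        _    = idₚ , λ ()
equal-size⇒carried {suc n} (b ∷ B) (b′ ∷ B′) size = by-heads b b′ size
  where
  lift : ∀ {c} {B₀ B₀′ : Subset n} → Σ (Permutation′ n) (λ π → Carries π B₀ B₀′) →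
    Σ (Permutation′ (suc n)) λ π → Carries π (c ∷ B₀) (c ∷ B₀′)
  lift (π , carries) = lift₀ π , λ { zero → refl ; (suc u) → carries u }

  -- Send 0 to an element j of B₀′ and the rest of B₀ onto B₀′ ∖ {j}.
  in-out : ∀ (B₀ B₀′ : Subset n) → suc ∣ B₀ ∣ ≡ ∣ B₀′ ∣ →
    Σ (Permutation′ (suc n)) λ π → Carries π (true ∷ B₀) (false ∷ B₀′)
  in-out B₀ B₀′ size₀ with remove-element B₀′ ∣ B₀ ∣ (sym size₀)
  ... | j , j∈B₀′ , R , ∣R∣ , j∉R , agree with equal-size⇒carried B₀ R (sym ∣R∣)
  ...   | π , carries = lift₀ π ∘ₚ transposition zero (suc j) , carried
    where
    carried : Carries (lift₀ π ∘ₚ transposition zero (suc j)) (true ∷ B₀) (false ∷ B₀′)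
    carried zero    = trans (cong (lookup (false ∷ B₀′)) (swap-a zero (suc j))) j∈B₀′
    carried (suc u) with swapView zero (suc j) (suc (π ⟨$⟩ʳ u))
    ... | at-a () _
    ... | at-b _ πu≡j e = begin
      lookup (false ∷ B₀′) (swap zero (suc j) (suc (π ⟨$⟩ʳ u))) ≡⟨ cong (lookup (false ∷ B₀′)) e ⟩
      false                                                     ≡⟨ sym j∉R ⟩
      lookup R j                                                ≡⟨ cong (lookup R) (Fin-suc-injective πu≡j) ⟨
      lookup R (π ⟨$⟩ʳ u)                                       ≡⟨ carries u ⟩
      lookup B₀ u                                               ∎
      where open ≡-Reasoning
    ... | elsewhere _ πu≢j e = begin
      lookup (false ∷ B₀′) (swap zero (suc j) (suc (π ⟨$⟩ʳ u))) ≡⟨ cong (lookup (false ∷ B₀′)) e ⟩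
      lookup B₀′ (π ⟨$⟩ʳ u)                                     ≡⟨ agree _ (λ p → πu≢j (cong suc p)) ⟨
      lookup R (π ⟨$⟩ʳ u)                                       ≡⟨ carries u ⟩
      lookup B₀ u                                               ∎
      where open ≡-Reasoning

  by-heads : ∀ c c′ → ∣ c ∷ B ∣ ≡ ∣ c′ ∷ B′ ∣ → Σ (Permutation′ (suc n)) λ π → Carries π (c ∷ B) (c′ ∷ B′)
  by-heads true  true  size′ = lift (equal-size⇒carried B B′ (suc-injective size′))
  by-heads false false size′ = lift (equal-size⇒carried B B′ size′)
  by-heads true  false size′ = in-out B B′ size′
  by-heads false true  size′ with in-out B′ B (sym size′)
  ... | π , carries = flip π , carries-inverse π (true ∷ B′) (false ∷ B) carries

carried-fixing : ∀ {n} (x₀ : Fin n) (B B′ : Subset n) → ∣ B ∣ ≡ ∣ B′ ∣ →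
  lookup B x₀ ≡ true → lookup B′ x₀ ≡ true →
  Σ (Permutation′ n) λ ρ → ρ ⟨$⟩ʳ x₀ ≡ x₀ × Carries ρ B B′
carried-fixing {n} x₀ B B′ size x₀∈B x₀∈B′ with equal-size⇒carried B B′ size
... | π , carries = π ∘ₚ transposition w x₀ , swap-a w x₀ , λ u → trans (stays (π ⟨$⟩ʳ u)) (carries u)
  where
  w : Fin n
  w = π ⟨$⟩ʳ x₀
  w∈B′ : lookup B′ w ≡ true
  w∈B′ = trans (carries x₀) x₀∈B
  -- (w x₀) swaps two elements of B′, so it maps B′ onto itself.
  stays : ∀ v → lookup B′ (swap w x₀ v) ≡ lookup B′ v
  stays v with swapView w x₀ v
  ... | at-a v≡w e      = trans (cong (lookup B′) e) (trans x₀∈B′ (trans (sym w∈B′) (cong (lookup B′) (sym v≡w))))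
  ... | at-b _ v≡x₀ e   = trans (cong (lookup B′) e) (trans w∈B′ (trans (sym x₀∈B′) (cong (lookup B′) (sym v≡x₀))))
  ... | elsewhere _ _ e = cong (lookup B′) e

indicator : Bool → ℕ
indicator true  = 1
indicator false = 0

size-as-sum : ∀ {n} (S : Subset n) → ∣ S ∣ ≡ sum (λ i → indicator (lookup S i))
size-as-sum []          = refl
size-as-sum (true ∷ S)  = cong suc (size-as-sum S)
size-as-sum (false ∷ S) = size-as-sum S

size-relabel : ∀ {n} (π : Permutation′ n) (S : Subset n) →
  ∣ tabulate (λ u → lookup S (π ⟨$⟩ʳ u)) ∣ ≡ ∣ S ∣
size-relabel {n} π S = begin
  ∣ relabelled ∣
    ≡⟨ size-as-sum relabelled ⟩
  sum (λ i → indicator (lookup relabelled i))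
    ≡⟨ sum-cong-≗ {n} (λ i → cong indicator (lookup∘tabulate (λ u → lookup S (π ⟨$⟩ʳ u)) i)) ⟩
  sum (λ i → indicator (lookup S (π ⟨$⟩ʳ i)))
    ≡⟨ sum-permute (λ i → indicator (lookup S i)) π ⟨
  sum (λ i → indicator (lookup S i))
    ≡⟨ size-as-sum S ⟨
  ∣ S ∣ ∎
  where
  open ≡-Reasoning
  relabelled : Subset n
  relabelled = tabulate (λ u → lookup S (π ⟨$⟩ʳ u))

block : ∀ {n} → Vec (Subset n) n → Fin n → Fin n → Bool
block v w u = lookup (lookup v w) u

block-tabulate : ∀ {n} (f : Fin n → Fin n → Bool) w u →
  block (tabulate λ w′ → tabulate λ u′ → f w′ u′) w u ≡ f w u
block-tabulate f w u = trans (cong (λ S → lookup S u) (lookup∘tabulate _ w)) (lookup∘tabulate (f w) u)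

block-ext : ∀ {n} {v v′ : Vec (Subset n) n} → (∀ w u → block v w u ≡ block v′ w u) → v ≡ v′
block-ext same = vec-ext λ w → vec-ext (same w)

-- Equality of matchings is decidable, hence proof-irrelevant.
matchings-uip : ∀ {n} {v v′ : Vec (Subset n) n} (p q : v ≡ v′) → p ≡ q
matchings-uip = Decidable⇒UIP.≡-irrelevant (≡-dec (≡-dec _≟B_))

record IsPM {n} (s : ℕ) (v : Vec (Subset n) n) : Set where
  field
    own-block : ∀ w → T (block v w w)
    size      : ∀ w → ∣ lookup v w ∣ ≡ s
    closed    : ∀ w y → T (block v w y) → lookup v y ≡ lookup v w

isPM-sound : ∀ {n} s (v : Vec (Subset n) n) → T (isPerfectMatching s v) → IsPM s v
isPM-sound s v pm = record
  { own-block = λ w → proj₁ (split w)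
  ; size      = λ w → ≡ᵇ⇒≡ _ s (proj₁ (Equivalence.to T-∧ (proj₂ (split w))))
  ; closed    = closed
  }
  where
  split : ∀ w → T (block v w w) × T ((∣ lookup v w ∣ ≡ᵇ s) ∧
                  allF (λ y → not (block v w y) ∨ (lookup v y ==S lookup v w)))
  split w = Equivalence.to T-∧ (allF⇒∀ _ pm w)
  closed : ∀ w y → T (block v w y) → lookup v y ≡ lookup v w
  closed w y y∈w with Equivalence.to T-∨ (allF⇒∀ _ (proj₂ (Equivalence.to T-∧ (proj₂ (split w)))) y)
  ... | inj₁ y∉w = ⊥-elim (subst T (Equivalence.to T-not-≡ y∉w) y∈w)
  ... | inj₂ same = ==S⇒≡ same

isPM-complete : ∀ {n} s (v : Vec (Subset n) n) → IsPM s v → T (isPerfectMatching s v)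
isPM-complete s v pm = ∀⇒allF _ λ w →
  Equivalence.from T-∧ (own-block w , Equivalence.from T-∧ (≡⇒≡ᵇ _ s (size w) , ∀⇒allF _ (closedᵇ w)))
  where
  open IsPM pm
  closedᵇ : ∀ w y → T (not (block v w y) ∨ (lookup v y ==S lookup v w))
  closedᵇ w y with block v w y in y∈w
  ... | false = tt
  ... | true  = ≡⇒==S (closed w y (subst T (sym y∈w) tt))

-- relabel h v has u in the block of w iff h u is in the block of h w;
-- for a permutation σ, relabel σ N is the matching σ⁻¹N.
relabel : ∀ {n} → (Fin n → Fin n) → Vec (Subset n) n → Vec (Subset n) n
relabel h v = tabulate λ w → tabulate λ u → block v (h w) (h u)

relabel-block : ∀ {n} h (v : Vec (Subset n) n) w u → block (relabel h v) w u ≡ block v (h w) (h u)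
relabel-block h v = block-tabulate (λ w u → block v (h w) (h u))

act-block : ∀ {n} (σ : Permutation′ n) (v : Vec (Subset n) n) w u →
  block (act (σ ⟨$⟩ʳ_) v) w u ≡ block v (σ ⟨$⟩ˡ w) (σ ⟨$⟩ˡ u)
act-block {n} σ v w u = trans unfold (T-ext forward backward)
  where
  inImage : Fin n → Bool
  inImage y = lookup (image (σ ⟨$⟩ʳ_) (lookup v y)) u
  inImage-unfold : ∀ y → inImage y ≡ anyF (λ y′ → block v y y′ ∧ ((σ ⟨$⟩ʳ y′) ==F u))
  inImage-unfold y = lookup∘tabulate _ u
  unfold : block (act (σ ⟨$⟩ʳ_) v) w u ≡ anyF (λ y → ((σ ⟨$⟩ʳ y) ==F w) ∧ inImage y)
  unfold = block-tabulate _ w u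
  preimage : ∀ {y w′} → T ((σ ⟨$⟩ʳ y) ==F w′) → y ≡ σ ⟨$⟩ˡ w′
  preimage σy≡w′ = trans (sym (inverseˡ σ)) (cong (σ ⟨$⟩ˡ_) (==F⇒≡ σy≡w′))
  forward : T (anyF (λ y → ((σ ⟨$⟩ʳ y) ==F w) ∧ inImage y)) → T (block v (σ ⟨$⟩ˡ w) (σ ⟨$⟩ˡ u))
  forward h with anyF⇒∃ _ h
  ... | y , hy with Equivalence.to (T-∧ {(σ ⟨$⟩ʳ y) ==F w}) hy
  ... | σy≡w , u∈σ[y] with anyF⇒∃ _ (subst T (inImage-unfold y) u∈σ[y])
  ... | y′ , hy′ with Equivalence.to (T-∧ {block v y y′}) hy′
  ... | y′∈y , σy′≡u = subst₂ (λ a b → T (block v a b)) (preimage σy≡w) (preimage σy′≡u) y′∈y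
  backward : T (block v (σ ⟨$⟩ˡ w) (σ ⟨$⟩ˡ u)) → T (anyF (λ y → ((σ ⟨$⟩ʳ y) ==F w) ∧ inImage y))
  backward h = ∃⇒anyF _ (σ ⟨$⟩ˡ w) (Equivalence.from T-∧ (≡⇒==F (inverseʳ σ) ,
    subst T (sym (inImage-unfold (σ ⟨$⟩ˡ w)))
      (∃⇒anyF _ (σ ⟨$⟩ˡ u) (Equivalence.from T-∧ (h , ≡⇒==F (inverseʳ σ))))))

-- Relabelling by a permutation preserves being a perfect matching; the
-- block sizes survive because relabelling a subset keeps its size.
relabel-isPM : ∀ {n} s (π : Permutation′ n) (v : Vec (Subset n) n) →
  IsPM s v → IsPM s (relabel (π ⟨$⟩ʳ_) v)
relabel-isPM {n} s π v pm = record
  { own-block = λ w → subst T (sym (relabel-block (π ⟨$⟩ʳ_) v w w)) (own-block (π ⟨$⟩ʳ w))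
  ; size      = λ w → trans (cong ∣_∣ (lookup∘tabulate _ w))
                        (trans (size-relabel π (lookup v (π ⟨$⟩ʳ w))) (size (π ⟨$⟩ʳ w)))
  ; closed    = closed′
  }
  where
  open IsPM pm
  relabelled : Subset n → Subset n
  relabelled S = tabulate λ u → lookup S (π ⟨$⟩ʳ u)
  closed′ : ∀ w y → T (block (relabel (π ⟨$⟩ʳ_) v) w y) → lookup (relabel (π ⟨$⟩ʳ_) v) y ≡ lookup (relabel (π ⟨$⟩ʳ_) v) w
  closed′ w y y∈w = begin
    lookup (relabel (π ⟨$⟩ʳ_) v) y   ≡⟨ lookup∘tabulate _ y ⟩
    relabelled (lookup v (π ⟨$⟩ʳ y)) ≡⟨ cong relabelled (closed _ _ (subst T (relabel-block (π ⟨$⟩ʳ_) v w y) y∈w)) ⟩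
    relabelled (lookup v (π ⟨$⟩ʳ w)) ≡⟨ lookup∘tabulate _ w ⟨
    lookup (relabel (π ⟨$⟩ʳ_) v) w   ∎
    where open ≡-Reasoning

act-relabel : ∀ {n} (σ : Permutation′ n) (v : Vec (Subset n) n) →
  act (σ ⟨$⟩ʳ_) (relabel (σ ⟨$⟩ʳ_) v) ≡ v
act-relabel σ v = block-ext λ w u →
  trans (act-block σ (relabel (σ ⟨$⟩ʳ_) v) w u)
    (trans (relabel-block (σ ⟨$⟩ʳ_) v (σ ⟨$⟩ˡ w) (σ ⟨$⟩ˡ u))
      (cong₂ (block v) (inverseʳ σ) (inverseʳ σ)))

relabel-act : ∀ {n} (σ : Permutation′ n) (v : Vec (Subset n) n) →
  relabel (σ ⟨$⟩ʳ_) (act (σ ⟨$⟩ʳ_) v) ≡ v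
relabel-act σ v = block-ext λ w u →
  trans (relabel-block (σ ⟨$⟩ʳ_) (act (σ ⟨$⟩ʳ_) v) w u)
    (trans (act-block σ v (σ ⟨$⟩ʳ w) (σ ⟨$⟩ʳ u))
      (cong₂ (block v) (inverseˡ σ) (inverseˡ σ)))

∅ : ∀ {n} → VSet n
∅ _ = ⊥

edgeTail : ∀ {n t} → (Fin (suc t) → Fin n) → Vec (Fin n) t
edgeTail x = tabulate λ j → x (suc j)

edgeSet-sound : ∀ {n s} (x : Fin s → Fin n) u → T (lookup (edgeSet x) u) → ∃ λ k → u ≡ x k
edgeSet-sound x u u∈e with anyF⇒∃ _ (subst T (lookup∘tabulate _ u) u∈e)
... | k , u≡xk = k , ==F⇒≡ u≡xk

edgeSet-complete : ∀ {n s} (x : Fin s → Fin n) u k → u ≡ x k → T (lookup (edgeSet x) u)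
edgeSet-complete x u k u≡xk = subst T (sym (lookup∘tabulate _ u)) (∃⇒anyF _ k (≡⇒==F u≡xk))

increasing⇒injective : ∀ {n s} (x : Fin s → Fin n) → StrictlyIncreasing x → ∀ {i j} → x i ≡ x j → i ≡ j
increasing⇒injective x increasing {i} {j} xi≡xj with <-cmp i j
... | tri< i<j _ _ = ⊥-elim (<⇒≢ (increasing i j i<j) xi≡xj)
... | tri≈ _ i≡j _ = i≡j
... | tri> _ _ j<i = ⊥-elim (<⇒≢ (increasing j i j<i) (sym xi≡xj))

suc≢zero : ∀ {m} {j : Fin m} → Fin.suc j ≢ zero
suc≢zero ()

distinct⇒Fresh : ∀ {n m} (F : VSet n) (ys : Vec (Fin n) m) → (∀ j → ¬ F (lookup ys j)) →
  (∀ i j → lookup ys i ≡ lookup ys j → i ≡ j) → Fresh F ys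
distinct⇒Fresh F []       _       _        = tt
distinct⇒Fresh F (y ∷ ys) outside distinct =
  outside zero ,
  distinct⇒Fresh (F ∪｛ y ｝) ys
    (λ j → [ outside (suc j) , (λ yⱼ≡y → suc≢zero (distinct (suc j) zero yⱼ≡y)) ]′)
    (λ i j p → Fin-suc-injective (distinct (suc i) (suc j) p))

edgeTail-fresh : ∀ {n t} (x : Fin (suc t) → Fin n) → StrictlyIncreasing x → Fresh (∅ ∪｛ x zero ｝) (edgeTail x)
edgeTail-fresh x increasing = distinct⇒Fresh _ (edgeTail x)
  (λ j → [ (λ ()) , (λ xⱼ≡x₁ → suc≢zero (injective (trans (sym (lookup∘tabulate _ j)) xⱼ≡x₁))) ]′)
  (λ i j p → Fin-suc-injective (injective (trans (sym (lookup∘tabulate _ i)) (trans p (lookup∘tabulate _ j)))))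
  where
  injective : ∀ {i j} → x i ≡ x j → i ≡ j
  injective = increasing⇒injective x increasing

sigma≡swaps : ∀ {n} t (x : Fin (suc t) → Fin n) (z : Vec (Fin n) t) y →
  sigma x z y ≡ swaps (edgeTail x) z ⟨$⟩ʳ y
sigma≡swaps zero    x []       y = refl
sigma≡swaps (suc t) x (z ∷ zs) y = cong (swap (x (suc zero)) z) (sigma≡swaps t (λ k → x (suc k)) zs y)

Avoids : ∀ {n t} → VSet n → (Fin (suc t) → Fin n) → Vec (Fin n) t → Set
Avoids {t = t} F x z =
  ∀ (j : Fin t) → ¬ F (lookup z j) × (∀ (k : Fin (suc t)) → toℕ k ≤ toℕ j → lookup z j ≢ x k)

validZ⇒Avoids : ∀ {n t} (x : Fin (suc t) → Fin n) z → T (validZ x z) → Avoids ∅ x z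
validZ⇒Avoids x z valid j = (λ ()) , λ k k≤j zⱼ≡xₖ →
  [ (λ k≰j → subst T (Equivalence.to T-not-≡ k≰j) (≤⇒≤ᵇ k≤j))
  , (λ zⱼ≢xₖ → subst T (Equivalence.to T-not-≡ zⱼ≢xₖ) (≡⇒==F zⱼ≡xₖ)) ]′
    (Equivalence.to T-∨ (allF⇒∀ _ (allF⇒∀ _ valid j) k))

Avoids⇒validZ : ∀ {n t} (x : Fin (suc t) → Fin n) z → Avoids ∅ x z → T (validZ x z)
Avoids⇒validZ x z avoids = ∀⇒allF _ λ j → ∀⇒allF _ λ k → test j k
  where
  test : ∀ j k → T (not (toℕ k ≤ᵇ toℕ j) ∨ not (lookup z j ==F x k))
  test j k with toℕ k ≤ᵇ toℕ j in k≤ᵇj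
  ... | false = tt
  ... | true with lookup z j ==F x k in zⱼ=xₖ
  ...   | false = tt
  ...   | true  = proj₂ (avoids j) k (≤ᵇ⇒≤ _ _ (subst T (sym k≤ᵇj) tt)) (true⇒≡ zⱼ=xₖ)

Avoids⇒Admissible : ∀ {n} t (F : VSet n) (x : Fin (suc t) → Fin n) z →
  Avoids F x z → Admissible (F ∪｛ x zero ｝) (edgeTail x) z
Avoids⇒Admissible zero    F x []       _      = tt
Avoids⇒Admissible (suc t) F x (z ∷ zs) avoids =
  [ proj₁ (avoids zero) , proj₂ (avoids zero) zero z≤n ]′ ,
  Avoids⇒Admissible t (F ∪｛ x zero ｝) (λ k → x (suc k)) zs avoids′
  where
  avoids′ : Avoids (F ∪｛ x zero ｝) (λ k → x (suc k)) zs
  avoids′ j = [ proj₁ (avoids (suc j)) , proj₂ (avoids (suc j)) zero z≤n ]′ ,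
              λ k k≤j → proj₂ (avoids (suc j)) (suc k) (s≤s k≤j)

Admissible⇒Avoids : ∀ {n} t (F : VSet n) (x : Fin (suc t) → Fin n) z →
  Admissible (F ∪｛ x zero ｝) (edgeTail x) z → Avoids F x z
Admissible⇒Avoids (suc t) F x (z ∷ zs) (z∉F∪x₁ , zs-adm) = avoids
  where
  avoids′ : Avoids (F ∪｛ x zero ｝) (λ k → x (suc k)) zs
  avoids′ = Admissible⇒Avoids t (F ∪｛ x zero ｝) (λ k → x (suc k)) zs zs-adm
  avoids : Avoids F x (z ∷ zs)
  avoids zero    = (λ z∈F → z∉F∪x₁ (inj₁ z∈F)) , λ { zero _ z≡x₁ → z∉F∪x₁ (inj₂ z≡x₁) ; (suc k) () }
  avoids (suc j) = (λ zⱼ∈F → proj₁ (avoids′ j) (inj₁ zⱼ∈F)) ,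
    λ { zero _ zⱼ≡x₁ → proj₁ (avoids′ j) (inj₂ zⱼ≡x₁) ; (suc k) (s≤s k≤j) → proj₂ (avoids′ j) k k≤j }

module Fibres {n t : ℕ} (x : Fin (suc t) → Fin n) (increasing : StrictlyIncreasing x) where

  x₁ : Fin n
  x₁ = x zero

  F₁ : VSet n
  F₁ = ∅ ∪｛ x₁ ｝

  e : Subset n
  e = edgeSet x

  tail : Vec (Fin n) t
  tail = edgeTail x

  tail-fresh : Fresh F₁ tail
  tail-fresh = edgeTail-fresh x increasing

  σ : Vec (Fin n) t → Permutation′ n
  σ z = permutation (sigma x z) (swaps tail z ⟨$⟩ˡ_)
    (λ y → trans (sigma≡swaps t x z _) (inverseʳ (swaps tail z)))
    (λ y → trans (cong (swaps tail z ⟨$⟩ˡ_) (sigma≡swaps t x z y)) (inverseˡ (swaps tail z)))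

  σ-fixes-x₁ : ∀ z → Admissible F₁ tail z → σ z ⟨$⟩ʳ x₁ ≡ x₁
  σ-fixes-x₁ z adm = trans (sigma≡swaps t x z x₁) (swaps-fixes F₁ tail z tail-fresh adm x₁ (inj₂ refl))

  σ⁻¹-fixes-x₁ : ∀ z → Admissible F₁ tail z → σ z ⟨$⟩ˡ x₁ ≡ x₁
  σ⁻¹-fixes-x₁ z adm = trans (cong (σ z ⟨$⟩ˡ_) (sym (σ-fixes-x₁ z adm))) (inverseˡ (σ z))

  Listed : Vec (Fin n) t → Fin n → Set
  Listed ys w = w ≡ x₁ ⊎ ∃ λ j → lookup ys j ≡ w

  Enumerates : Vec (Fin n) t → Subset n → Set
  Enumerates ys B = (∀ w → T (lookup B w) → Listed ys w) × (∀ w → Listed ys w → T (lookup B w))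

  record Carriers (B : Subset n) : Set where
    constructor carrier
    field
      choice      : Vec (Fin n) t
      .admissible : Admissible F₁ tail choice
      .carries    : Carries (σ choice) e B

  record Enumerations (B : Subset n) : Set where
    constructor enumeration
    field
      entries     : Vec (Fin n) t
      .fresh      : Fresh F₁ entries
      .enumerates : Enumerates entries B

  carrier-≡ : ∀ {B} {z z′} .{adm adm′ c c′} → z ≡ z′ → carrier {B} z adm c ≡ carrier z′ adm′ c′
  carrier-≡ refl = refl

  enumeration-≡ : ∀ {B} {ys ys′} .{f f′ c c′} → ys ≡ ys′ → enumeration {B} ys f c ≡ enumeration ys′ f′ c′
  enumeration-≡ refl = refl

  image-entry : ∀ z j → lookup (images tail z) j ≡ σ z ⟨$⟩ʳ x (suc j)
  image-entry z j = trans (lookup-map j (swaps tail z ⟨$⟩ʳ_) tail)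
    (trans (cong (swaps tail z ⟨$⟩ʳ_) (lookup∘tabulate _ j)) (sym (sigma≡swaps t x z (x (suc j)))))

  listed⇒edge : ∀ z → Admissible F₁ tail z → ∀ u → Listed (images tail z) (σ z ⟨$⟩ʳ u) → ∃ λ k → u ≡ x k
  listed⇒edge z adm u (inj₁ σu≡x₁)        = zero , permutation-injective (σ z) (trans σu≡x₁ (sym (σ-fixes-x₁ z adm)))
  listed⇒edge z adm u (inj₂ (j , imⱼ≡σu)) = suc j , permutation-injective (σ z) (trans (sym imⱼ≡σu) (image-entry z j))

  edge⇒listed : ∀ z → Admissible F₁ tail z → ∀ u → (∃ λ k → u ≡ x k) → Listed (images tail z) (σ z ⟨$⟩ʳ u)
  edge⇒listed z adm u (zero , u≡x₁)  = inj₁ (trans (cong (σ z ⟨$⟩ʳ_) u≡x₁) (σ-fixes-x₁ z adm))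
  edge⇒listed z adm u (suc j , u≡xⱼ) = inj₂ (j , trans (image-entry z j) (cong (σ z ⟨$⟩ʳ_) (sym u≡xⱼ)))

  carries⇒enumerates : ∀ z B → Admissible F₁ tail z → Carries (σ z) e B → Enumerates (images tail z) B
  carries⇒enumerates z B adm carries = complete , sound
    where
    complete : ∀ w → T (lookup B w) → Listed (images tail z) w
    complete w w∈B = subst (Listed (images tail z)) (inverseʳ (σ z))
      (edge⇒listed z adm _ (edgeSet-sound x _ (subst T (sym (carries-inverse (σ z) e B carries w)) w∈B)))
    sound : ∀ w → Listed (images tail z) w → T (lookup B w)
    sound w listed with listed⇒edge z adm _ (subst (Listed (images tail z)) (sym (inverseʳ (σ z))) listed)
    ... | k , σ⁻¹w≡xₖ = subst T (carries-inverse (σ z) e B carries w) (edgeSet-complete x _ k σ⁻¹w≡xₖ)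

  enumerates⇒carries : ∀ z B → Admissible F₁ tail z → Enumerates (images tail z) B → Carries (σ z) e B
  enumerates⇒carries z B adm (complete , sound) u = T-ext
    (λ σu∈B → let k , u≡xₖ = listed⇒edge z adm u (complete _ σu∈B) in edgeSet-complete x u k u≡xₖ)
    (λ u∈e → sound _ (edge⇒listed z adm u (edgeSet-sound x u u∈e)))

  carriers↔enumerations : ∀ B → Carriers B ↔ Enumerations B
  carriers↔enumerations B = mk↔ₛ′ to from to∘from from∘to
    where
    to : Carriers B → Enumerations B
    to (carrier z adm carries) =
      enumeration (images tail z) (images-fresh F₁ tail z tail-fresh adm) (carries⇒enumerates z B adm carries)
    from : Enumerations B → Carriers B
    from (enumeration ys fresh enumerates) =
      carrier (recover tail ys) (recover-admissible F₁ tail ys tail-fresh fresh)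
        (enumerates⇒carries (recover tail ys) B (recover-admissible F₁ tail ys tail-fresh fresh)
          (subst (λ zs → Enumerates zs B) (sym (images-recover F₁ tail ys tail-fresh fresh)) enumerates))
    to∘from : ∀ y → to (from y) ≡ y
    to∘from (enumeration ys fresh _) =
      enumeration-≡ (recompute (≡-dec _≟F_ _ _) (images-recover F₁ tail ys tail-fresh fresh))
    from∘to : ∀ c → from (to c) ≡ c
    from∘to (carrier z adm _) =
      carrier-≡ (recompute (≡-dec _≟F_ _ _) (recover-images F₁ tail z tail-fresh adm))

  listed-map : ∀ (ρ : Permutation′ n) → ρ ⟨$⟩ʳ x₁ ≡ x₁ → ∀ ys u → Listed ys u → Listed (map (ρ ⟨$⟩ʳ_) ys) (ρ ⟨$⟩ʳ u)
  listed-map ρ fixes ys u (inj₁ u≡x₁)      = inj₁ (trans (cong (ρ ⟨$⟩ʳ_) u≡x₁) fixes)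
  listed-map ρ fixes ys u (inj₂ (j , yⱼ≡u)) = inj₂ (j , trans (lookup-map j (ρ ⟨$⟩ʳ_) ys) (cong (ρ ⟨$⟩ʳ_) yⱼ≡u))

  listed-unmap : ∀ (ρ : Permutation′ n) → ρ ⟨$⟩ʳ x₁ ≡ x₁ → ∀ ys w → Listed (map (ρ ⟨$⟩ʳ_) ys) w →
    Σ (Fin n) λ u → Listed ys u × ρ ⟨$⟩ʳ u ≡ w
  listed-unmap ρ fixes ys w (inj₁ w≡x₁)       = x₁ , inj₁ refl , trans fixes (sym w≡x₁)
  listed-unmap ρ fixes ys w (inj₂ (j , ρyⱼ≡w)) =
    lookup ys j , inj₂ (j , refl) , trans (sym (lookup-map j (ρ ⟨$⟩ʳ_) ys)) ρyⱼ≡w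

  relabel-fresh : ∀ (ρ : Permutation′ n) → ρ ⟨$⟩ʳ x₁ ≡ x₁ → (ys : Vec (Fin n) t) → Fresh F₁ ys → Fresh F₁ (map (ρ ⟨$⟩ʳ_) ys)
  relabel-fresh ρ fixes = Fresh-map F₁ F₁ ρ back
    where
    back : ∀ w → F₁ (ρ ⟨$⟩ʳ w) → F₁ w
    back w (inj₂ ρw≡x₁) = inj₂ (permutation-injective ρ (trans ρw≡x₁ (sym fixes)))

  relabel-enumerates : ∀ (ρ : Permutation′ n) B B′ → ρ ⟨$⟩ʳ x₁ ≡ x₁ → Carries ρ B B′ →
    ∀ ys → Enumerates ys B → Enumerates (map (ρ ⟨$⟩ʳ_) ys) B′
  relabel-enumerates ρ B B′ fixes carries ys (complete , sound) = complete′ , sound′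
    where
    complete′ : ∀ w → T (lookup B′ w) → Listed (map (ρ ⟨$⟩ʳ_) ys) w
    complete′ w w∈B′ = subst (Listed (map (ρ ⟨$⟩ʳ_) ys)) (inverseʳ ρ)
      (listed-map ρ fixes ys _ (complete _ (subst T (sym (carries-inverse ρ B B′ carries w)) w∈B′)))
    sound′ : ∀ w → Listed (map (ρ ⟨$⟩ʳ_) ys) w → T (lookup B′ w)
    sound′ w listed with listed-unmap ρ fixes ys w listed
    ... | u , u-listed , ρu≡w = subst (λ v → T (lookup B′ v)) ρu≡w (subst T (sym (carries u)) (sound u u-listed))

  enumerations↔ : ∀ (ρ : Permutation′ n) B B′ → ρ ⟨$⟩ʳ x₁ ≡ x₁ → Carries ρ B B′ →
    Enumerations B ↔ Enumerations B′
  enumerations↔ ρ B B′ fixes carries = mk↔ₛ′ (relabelled ρ B B′ fixes carries) (relabelled (flip ρ) B′ B fixes⁻¹ carries⁻¹)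
    (λ { (enumeration ys _ _) → enumeration-≡ (map-inverse (λ _ → inverseʳ ρ) ys) })
    (λ { (enumeration ys _ _) → enumeration-≡ (map-inverse (λ _ → inverseˡ ρ) ys) })
    where
    relabelled : ∀ (π : Permutation′ n) C C′ → π ⟨$⟩ʳ x₁ ≡ x₁ → Carries π C C′ → Enumerations C → Enumerations C′
    relabelled π C C′ fix carry (enumeration ys fresh enumerates) =
      enumeration (map (π ⟨$⟩ʳ_) ys) (relabel-fresh π fix ys fresh) (relabel-enumerates π C C′ fix carry ys enumerates)
    fixes⁻¹ : ρ ⟨$⟩ˡ x₁ ≡ x₁
    fixes⁻¹ = trans (cong (ρ ⟨$⟩ˡ_) (sym fixes)) (inverseˡ ρ)
    carries⁻¹ : Carries (flip ρ) B′ B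
    carries⁻¹ = carries-inverse ρ B B′ carries

  -- The fibre over N corresponds to the carriers of the block of x₁ in N:
  -- σ_z M = N with e ∈ M forces M = σ_z⁻¹ N, and σ_z⁻¹ N contains e
  -- exactly when σ_z carries e onto the block of x₁ = σ_z x₁ in N.
  module _ (N : PM n (suc t)) where

    blockOf : Subset n
    blockOf = lookup (proj₁ N) x₁

    preimage-contains-e : ∀ z → Admissible F₁ tail z → Carries (σ z) e blockOf →
      lookup (relabel (sigma x z) (proj₁ N)) x₁ ≡ e
    preimage-contains-e z adm carries = vec-ext λ u → begin
      block (relabel (sigma x z) (proj₁ N)) x₁ u       ≡⟨ relabel-block (sigma x z) (proj₁ N) x₁ u ⟩
      block (proj₁ N) (σ z ⟨$⟩ʳ x₁) (σ z ⟨$⟩ʳ u)       ≡⟨ cong (λ w → block (proj₁ N) w (σ z ⟨$⟩ʳ u)) (σ-fixes-x₁ z adm) ⟩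
      block (proj₁ N) x₁ (σ z ⟨$⟩ʳ u)                  ≡⟨ carries u ⟩
      lookup e u                                       ∎
      where open ≡-Reasoning

    fibre⇒carrier : Fiber n t x N → Carriers blockOf
    fibre⇒carrier (((M , _) , M∋e) , (z , valid) , σM≡N) = carrier z adm carries
      where
      adm : Admissible F₁ tail z
      adm = Avoids⇒Admissible t ∅ x z (validZ⇒Avoids x z valid)
      carries : Carries (σ z) e blockOf
      carries u = begin
        block (proj₁ N) x₁ (σ z ⟨$⟩ʳ u)                        ≡⟨ cong (λ V → block V x₁ (σ z ⟨$⟩ʳ u)) σM≡N ⟨
        block (act (sigma x z) M) x₁ (σ z ⟨$⟩ʳ u)              ≡⟨ act-block (σ z) M x₁ (σ z ⟨$⟩ʳ u) ⟩
        block M (σ z ⟨$⟩ˡ x₁) (σ z ⟨$⟩ˡ (σ z ⟨$⟩ʳ u))         ≡⟨ cong₂ (block M) (σ⁻¹-fixes-x₁ z adm) (inverseˡ (σ z)) ⟩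
        block M x₁ u                                           ≡⟨ cong (λ S → lookup S u) (==S⇒≡ M∋e) ⟩
        lookup e u                                             ∎
        where open ≡-Reasoning

    carrier⇒fibre : Carriers blockOf → Fiber n t x N
    carrier⇒fibre (carrier z adm carries) =
      (((relabel (sigma x z) (proj₁ N) , preimage-isPM) ,
        recompute (T? _) (≡⇒==S (preimage-contains-e z adm carries))) ,
       (z , recompute (T? _) (Avoids⇒validZ x z (Admissible⇒Avoids t ∅ x z adm))) ,
       act-relabel (σ z) (proj₁ N))
      where
      preimage-isPM : T (isPerfectMatching (suc t) (relabel (sigma x z) (proj₁ N)))
      preimage-isPM = isPM-complete (suc t) _ (relabel-isPM (suc t) (σ z) (proj₁ N) (isPM-sound (suc t) _ (proj₂ N)))

    fibre-≡ : ∀ {M M′ : Vec (Subset n) n} {pm pm′ e∈M e∈M′ z valid valid′ eq eq′} → M ≡ M′ →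
      _≡_ {A = Fiber n t x N} (((M , pm) , e∈M) , (z , valid) , eq) (((M′ , pm′) , e∈M′) , (z , valid′) , eq′)
    fibre-≡ {pm = pm} {pm′} {e∈M} {e∈M′} {valid = valid} {valid′} {eq} {eq′} refl
      with T-irrelevant pm pm′ | T-irrelevant e∈M e∈M′ | T-irrelevant valid valid′ | matchings-uip eq eq′
    ... | refl | refl | refl | refl = refl

    fibre↔carriers : Fiber n t x N ↔ Carriers blockOf
    fibre↔carriers = mk↔ₛ′ fibre⇒carrier carrier⇒fibre (λ _ → refl)
      (λ { (((M , _) , _) , (z , _) , σM≡N) →
             fibre-≡ (trans (cong (relabel (sigma x z)) (sym σM≡N)) (relabel-act (σ z) M)) })

    fibre↔enumerations : Fiber n t x N ↔ Enumerations blockOf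
    fibre↔enumerations = ↔-trans fibre↔carriers (carriers↔enumerations blockOf)

  -- The blocks of x₁ in any two perfect matchings have equally many enumerations:
  -- both have s elements and contain x₁, so a permutation fixing x₁ carries one onto the other.
  blockOf-size : ∀ (N : PM n (suc t)) → ∣ blockOf N ∣ ≡ suc t
  blockOf-size N = IsPM.size (isPM-sound (suc t) (proj₁ N) (proj₂ N)) x₁

  x₁∈blockOf : ∀ (N : PM n (suc t)) → lookup (blockOf N) x₁ ≡ true
  x₁∈blockOf N = Equivalence.to T-≡ (IsPM.own-block (isPM-sound (suc t) (proj₁ N) (proj₂ N)) x₁)

  blocks↔ : ∀ (N N′ : PM n (suc t)) → Enumerations (blockOf N) ↔ Enumerations (blockOf N′)
  blocks↔ N N′ with carried-fixing x₁ (blockOf N) (blockOf N′)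
                      (trans (blockOf-size N) (sym (blockOf-size N′))) (x₁∈blockOf N) (x₁∈blockOf N′)
  ... | ρ , fixes , carries = enumerations↔ ρ (blockOf N) (blockOf N′) fixes carries

mainTheorem17 : (n t : ℕ) → 1 ≤ t → suc t ∣ n →
    (x : Fin (suc t) → Fin n) → StrictlyIncreasing x →
    (N N′ : PM n (suc t)) → Fiber n t x N ↔ Fiber n t x N′
mainTheorem17 n t _ _ x increasing N N′ =
  ↔-trans (fibre↔enumerations N) (↔-trans (blocks↔ N N′) (↔-sym (fibre↔enumerations N′)))
  where open Fibres x increasing
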